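{- When a connected graph $G=(V,E)$ is oriented in a way that restricts to a bipartite orientation for a spanning tree $T \subset E$, then any edge $e=\{v,w\}$ has $$b_G(v) \equiv \pm b_G(w) \quad \mod \quad {\mathbb Z} e + {\mathbb Z} (E\setminus T) + \partial_{\operatorname{line} G} ( B_{\operatorname{line} G} ).$$
   Context: $G$ is simple. $b_G(v)\in{\mathbb Z}^E$ is the bond at $v$ (signed incidence vector of edges at $v$, the row of the boundary map $\partial_G$ indexed by $v$). $\operatorname{line} G$ is the line graph (vertex set $E$), with arbitrary orientation, boundary map $\partial_{\operatorname{line} G}:{\mathbb Z}^{E_{\operatorname{line} G}}\to{\mathbb Z}^E$ and bond lattice $B_{\operatorname{line} G}$. An orientation of $T$ is bipartite if at every vertex the edges of $T$ are all oriented toward it or all away from it. -}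

module Defs where

open import Data.Nat using (ℕ; zero; suc)
open import Data.Fin using (Fin; zero; suc; _≟_)
open import Data.Integer using (ℤ; +_; -_; _+_; _*_; _-_)
open import Data.Bool using (Bool; true; false; _∧_; _∨_; not; if_then_else_)
open import Data.Product using (_×_; _,_; Σ; ∃; ∃-syntax)
open import Data.Sum using (_⊎_)
open import Relation.Nullary using (¬_)
open import Relation.Nullary.Decidable using (⌊_⌋)
open import Relation.Binary.PropositionalEquality using (_≡_; _≢_)

sumFin : ∀ {n} → (Fin n → ℤ) → ℤ
sumFin {zero}  f = + 0
sumFin {suc n} f = f zero + sumFin (λ i → f (suc i))

_==_ : ∀ {n} → Fin n → Fin n → Bool
i == j = ⌊ i ≟ j ⌋

record OrientedSimpleGraph (n m : ℕ) : Set where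
  field
    tail head : Fin m → Fin n
    loopless  : ∀ f → tail f ≢ head f
    simple    : ∀ f g → f ≢ g →
                ¬ ((tail f ≡ tail g × head f ≡ head g) ⊎
                   (tail f ≡ head g × head f ≡ tail g))

module _ {n m : ℕ} (G : OrientedSimpleGraph n m) where
  open OrientedSimpleGraph G

  -- The bond b_G(v) ∈ ℤ^E: the row of ∂_G (∂_G f = head f - tail f)
  -- indexed by v.
  bond : Fin n → Fin m → ℤ
  bond v f = (if head f == v then + 1 else + 0)
           - (if tail f == v then + 1 else + 0)

  incident : Fin m → Fin n → Bool
  incident f v = (tail f == v) ∨ (head f == v)

  data Reach (S : Fin m → Bool) : Fin n → Fin n → Set where
    here  : ∀ {u} → Reach S u u
    step  : ∀ {u x f} → Reach S u x → S f ≡ true →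
            (tail f ≡ x ⊎ head f ≡ x) →
            Reach S u (if tail f == x then head f else tail f)

  Connected : Set
  Connected = ∀ u w → Reach (λ _ → true) u w

  remove : (Fin m → Bool) → Fin m → (Fin m → Bool)
  remove S f g = S g ∧ not (g == f)

  -- T ⊆ E is a spanning tree: (V, T) is connected, and minimally so
  -- (removing any edge of T disconnects its endpoints), i.e. acyclic.
  SpanningTree : (Fin m → Bool) → Set
  SpanningTree T = (∀ u w → Reach T u w)
                 × (∀ f → T f ≡ true → ¬ Reach (remove T f) (tail f) (head f))

  BipartiteOn : (Fin m → Bool) → Set
  BipartiteOn T = ∀ x f g → T f ≡ true → T g ≡ true →
                  ¬ (head f ≡ x × tail g ≡ x)

  lineAdj : Fin m → Fin m → Bool
  lineAdj f g = not (f == g) ∧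
    ((tail f == tail g) ∨ (tail f == head g) ∨
     (head f == tail g) ∨ (head f == head g))

  -- An orientation of line G: o f g = true means the line-edge {f, g}
  -- is oriented f → g; exactly one direction is chosen.
  LineOrientation : (Fin m → Fin m → Bool) → Set
  LineOrientation o = ∀ f g → lineAdj f g ≡ true → o f g ≡ not (o g f)

  module _ (o : Fin m → Fin m → Bool) where
    -- the oriented edges of line G are the pairs (f , g) with
    -- lineArc f g = true; chains in ℤ^{E_line G} are functions
    -- Fin m → Fin m → ℤ (values off lineArc pairs are irrelevant).
    lineArc : Fin m → Fin m → Bool
    lineArc f g = lineAdj f g ∧ o f g

    lineBond : Fin m → Fin m → Fin m → ℤ
    lineBond h f g = if lineArc f g
      then ((if g == h then + 1 else + 0) - (if f == h then + 1 else + 0))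
      else + 0

    lineBoundary : (Fin m → Fin m → ℤ) → Fin m → ℤ
    lineBoundary z h = sumFin (λ f → sumFin (λ g → lineBond h f g * z f g))

    InLineBondLattice : (Fin m → Fin m → ℤ) → Set
    InLineBondLattice z = Σ (Fin m → ℤ) λ y → (∀ f g → z f g ≡ sumFin (λ h → y h * lineBond h f g))

    InLattice : (T : Fin m → Bool) → (e : Fin m) → (Fin m → ℤ) → Set
    InLattice T e x =
      Σ ℤ λ a → Σ (Fin m → ℤ) λ c → Σ (Fin m → Fin m → ℤ) λ z → (InLineBondLattice z ×
        (∀ f → x f ≡ (if f == e then a else + 0)
                    + (if T f then + 0 else c f)
                    + lineBoundary z f))

  CongMod : (o : Fin m → Fin m → Bool) (T : Fin m → Bool) (e : Fin m) →
            (Fin m → ℤ) → (Fin m → ℤ) → Set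
  CongMod o T e x y = InLattice o T e (λ f → x f - y f)

-- Since T is bipartite, every vertex x is a sink or a source of T, so on T
-- the bond b_G(x) is ± the incidence vector of x.  For e = {v, w} and a
-- suitable sign, b_G(v) ∓ b_G(w) is therefore, on T ∖ {e}, a multiple of
-- the incidence vector of v plus that of w, i.e. of the set of edges
-- adjacent to e in line G.  That set is, up to sign and away from e, the
-- boundary ∂_{line G} of the bond of line G at e (an off-diagonal column of
-- the Laplacian of line G); the coordinates at e and outside T are absorbed
-- by ℤ e + ℤ (E ∖ T).

module Submission where

open import Defs
open import Data.Nat using (ℕ; zero; suc)
open import Data.Fin using (Fin; zero; suc; _≟_)
open import Data.Fin.Properties using (suc-injective; any?)
open import Data.Integer using (ℤ; +_; -_; _+_; _*_; _-_; 1ℤ; -1ℤ)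
open import Data.Integer.Properties
  using (+-identityˡ; +-identityʳ; +-comm; *-zeroˡ; *-zeroʳ; *-distribˡ-+;
         neg-distrib-+; *-commutativeSemigroup)
open import Data.Integer.Tactic.RingSolver using (solve-∀)
open import Algebra.Properties.CommutativeSemigroup *-commutativeSemigroup
  using (x∙yz≈y∙xz)
open import Data.Bool using (Bool; true; false; _∧_; _∨_; not; if_then_else_)
import Data.Bool.Properties as Bool
open import Data.Sum using (_⊎_; inj₁; inj₂)
open import Data.Product using (_×_; _,_)
open import Relation.Nullary using (¬_; Dec; yes; no; contradiction)
open import Relation.Nullary.Decidable using (isYes≗does; dec-true; dec-false; _×-dec_)
open import Relation.Binary.PropositionalEquality
  using (_≡_; _≢_; refl; sym; trans; cong; cong₂; module ≡-Reasoning)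
open ≡-Reasoning

⟦_⟧ : Bool → ℤ
⟦ b ⟧ = if b then + 1 else + 0

minus-plus : ∀ (p q : ℤ) → (p - q) + q ≡ p
minus-plus = solve-∀

neg-*-neg : ∀ (i j : ℤ) → - i * - j ≡ i * j
neg-*-neg = solve-∀

sub-neg : ∀ (a b : ℤ) → a - - b ≡ 1ℤ * (a + b)
sub-neg = solve-∀

neg-sub : ∀ (a b : ℤ) → - a - b ≡ -1ℤ * (a + b)
neg-sub = solve-∀

neg-sub-neg-neg : ∀ (a b : ℤ) → - a - - - b ≡ -1ℤ * (a + b)
neg-sub-neg-neg = solve-∀

==-refl : ∀ {n} (i : Fin n) → (i == i) ≡ true
==-refl i = trans (isYes≗does (i ≟ i)) (dec-true (i ≟ i) refl)

==-false : ∀ {n} {i j : Fin n} → i ≢ j → (i == j) ≡ false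
==-false {i = i} {j} i≢j = trans (isYes≗does (i ≟ j)) (dec-false (i ≟ j) i≢j)

==-sym : ∀ {n} (i j : Fin n) → (i == j) ≡ (j == i)
==-sym i j with i ≟ j | j ≟ i
... | yes _   | yes _   = refl
... | no _    | no _    = refl
... | yes i≡j | no j≢i  = contradiction (sym i≡j) j≢i
... | no i≢j  | yes j≡i = contradiction (sym j≡i) i≢j

==-∧-false : ∀ {n} (i j k l : Fin n) → ¬ (i ≡ j × k ≡ l) → (i == j) ∧ (k == l) ≡ false
==-∧-false i j k l ¬both with i ≟ j | k ≟ l
... | yes i≡j | yes k≡l = contradiction (i≡j , k≡l) ¬both
... | yes _   | no _    = refl
... | no _    | _       = refl

⟦∨⟧-disjoint : ∀ a b c d →
  a ∧ b ≡ false → a ∧ c ≡ false → a ∧ d ≡ false →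
  b ∧ c ≡ false → b ∧ d ≡ false → c ∧ d ≡ false →
  ⟦ a ∨ c ⟧ + ⟦ b ∨ d ⟧ ≡ ⟦ a ∨ b ∨ c ∨ d ⟧
⟦∨⟧-disjoint true  true  _     _     () _  _  _  _  _
⟦∨⟧-disjoint true  false true  _     _  () _  _  _  _
⟦∨⟧-disjoint true  false false true  _  _  () _  _  _
⟦∨⟧-disjoint true  false false false _  _  _  _  _  _  = refl
⟦∨⟧-disjoint false true  true  _     _  _  _  () _  _
⟦∨⟧-disjoint false true  false true  _  _  _  _  () _
⟦∨⟧-disjoint false true  false false _  _  _  _  _  _  = refl
⟦∨⟧-disjoint false false true  true  _  _  _  _  _  ()
⟦∨⟧-disjoint false false true  false _  _  _  _  _  _  = refl
⟦∨⟧-disjoint false false false true  _  _  _  _  _  _  = refl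
⟦∨⟧-disjoint false false false false _  _  _  _  _  _  = refl

∨-swap-middle : ∀ a b c d → (a ∨ b ∨ c ∨ d) ≡ (a ∨ c ∨ b ∨ d)
∨-swap-middle true  b     c     d = refl
∨-swap-middle false true  true  d = refl
∨-swap-middle false true  false d = refl
∨-swap-middle false false c     d = refl

sumFin-cong : ∀ {m} {F G : Fin m → ℤ} → (∀ i → F i ≡ G i) → sumFin F ≡ sumFin G
sumFin-cong {zero}  F≗G = refl
sumFin-cong {suc m} F≗G = cong₂ _+_ (F≗G zero) (sumFin-cong (λ i → F≗G (suc i)))

sumFin-*ˡ : ∀ {m} (c : ℤ) (F : Fin m → ℤ) → sumFin (λ i → c * F i) ≡ c * sumFin F
sumFin-*ˡ {zero}  c F = sym (*-zeroʳ c)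
sumFin-*ˡ {suc m} c F = begin
  c * F zero + sumFin (λ i → c * F (suc i)) ≡⟨ cong (_+_ (c * F zero)) (sumFin-*ˡ c (λ i → F (suc i))) ⟩
  c * F zero + c * sumFin (λ i → F (suc i)) ≡⟨ sym (*-distribˡ-+ c _ _) ⟩
  c * sumFin F                              ∎

sumFin-zero : ∀ {m} (F : Fin m → ℤ) → (∀ i → F i ≡ + 0) → sumFin F ≡ + 0
sumFin-zero {zero}  F F≗0 = refl
sumFin-zero {suc m} F F≗0 = cong₂ _+_ (F≗0 zero) (sumFin-zero _ (λ i → F≗0 (suc i)))

sumFin-single : ∀ {m} (F : Fin m → ℤ) k → (∀ i → i ≢ k → F i ≡ + 0) → sumFin F ≡ F k
sumFin-single F zero    off = begin
  F zero + sumFin (λ i → F (suc i)) ≡⟨ cong (_+_ (F zero)) (sumFin-zero _ (λ i → off (suc i) λ ())) ⟩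
  F zero + + 0                      ≡⟨ +-identityʳ (F zero) ⟩
  F zero                            ∎
sumFin-single F (suc k) off = begin
  F zero + sumFin (λ i → F (suc i)) ≡⟨ cong₂ _+_ (off zero λ ()) (sumFin-single _ k off′) ⟩
  + 0 + F (suc k)                   ≡⟨ +-identityˡ (F (suc k)) ⟩
  F (suc k)                         ∎
  where
  off′ : ∀ i → i ≢ k → F (suc i) ≡ + 0
  off′ i i≢k = off (suc i) (λ si≡sk → i≢k (suc-injective si≡sk))

sumFin-pair : ∀ {m} (F : Fin m → ℤ) k l → k ≢ l →
              (∀ i → i ≢ k → i ≢ l → F i ≡ + 0) → sumFin F ≡ F k + F l
sumFin-pair F zero    zero    k≢l off = contradiction refl k≢l
sumFin-pair F zero    (suc l) k≢l off =
  cong (_+_ (F zero)) (sumFin-single _ l (λ i i≢l → off (suc i) (λ ()) (λ si≡sl → i≢l (suc-injective si≡sl))))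
sumFin-pair F (suc k) zero    k≢l off = begin
  F zero + sumFin (λ i → F (suc i)) ≡⟨ cong (_+_ (F zero)) (sumFin-single _ k off′) ⟩
  F zero + F (suc k)                ≡⟨ +-comm (F zero) (F (suc k)) ⟩
  F (suc k) + F zero                ∎
  where
  off′ : ∀ i → i ≢ k → F (suc i) ≡ + 0
  off′ i i≢k = off (suc i) (λ si≡sk → i≢k (suc-injective si≡sk)) (λ ())
sumFin-pair F (suc k) (suc l) k≢l off = begin
  F zero + sumFin (λ i → F (suc i)) ≡⟨ cong₂ _+_ (off zero (λ ()) (λ ())) (sumFin-pair _ k l (λ k≡l → k≢l (cong suc k≡l)) off′) ⟩
  + 0 + (F (suc k) + F (suc l))     ≡⟨ +-identityˡ _ ⟩
  F (suc k) + F (suc l)             ∎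
  where
  off′ : ∀ i → i ≢ k → i ≢ l → F (suc i) ≡ + 0
  off′ i i≢k i≢l = off (suc i) (λ si≡sk → i≢k (suc-injective si≡sk)) (λ si≡sl → i≢l (suc-injective si≡sl))

module _ {n m : ℕ} (G : OrientedSimpleGraph n m) where
  open OrientedSimpleGraph G

  Sink Source : (Fin m → Bool) → Fin n → Set
  Sink   T x = ∀ f → T f ≡ true → tail f ≢ x
  Source T x = ∀ f → T f ≡ true → head f ≢ x

  sink-or-source : ∀ {T} → BipartiteOn G T → ∀ x → Sink T x ⊎ Source T x
  sink-or-source {T} bipartite x with any? (λ g → (T g Bool.≟ true) ×-dec (head g ≟ x))
  ... | yes (g , g∈T , g→x) = inj₁ (λ f f∈T x→f → bipartite x g f g∈T f∈T (g→x , x→f))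
  ... | no ¬into-x          = inj₂ (λ f f∈T f→x → ¬into-x (f , f∈T , f→x))

  bond-sink : ∀ {T x f} → Sink T x → T f ≡ true → bond G x f ≡ ⟦ incident G f x ⟧
  bond-sink {x = x} {f} sink f∈T rewrite ==-false (sink f f∈T) = +-identityʳ ⟦ head f == x ⟧

  bond-source : ∀ {T x f} → Source T x → T f ≡ true → bond G x f ≡ - ⟦ incident G f x ⟧
  bond-source {x = x} {f} source f∈T rewrite ==-false (source f f∈T) with tail f == x
  ... | true  = refl
  ... | false = refl

  incident-endpoints : ∀ {f e} → f ≢ e →
    ⟦ incident G f (tail e) ⟧ + ⟦ incident G f (head e) ⟧ ≡ ⟦ lineAdj G f e ⟧
  incident-endpoints {f} {e} f≢e rewrite ==-false f≢e =
    ⟦∨⟧-disjoint (tail f == tail e) (tail f == head e) (head f == tail e) (head f == head e)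
      (==-∧-false (tail f) (tail e) (tail f) (head e) (λ (p , q) → loopless e (trans (sym p) q)))
      (==-∧-false (tail f) (tail e) (head f) (tail e) (λ (p , q) → loopless f (trans p (sym q))))
      (==-∧-false (tail f) (tail e) (head f) (head e) (λ tt,hh → simple f e f≢e (inj₁ tt,hh)))
      (==-∧-false (tail f) (head e) (head f) (tail e) (λ th,ht → simple f e f≢e (inj₂ th,ht)))
      (==-∧-false (tail f) (head e) (head f) (head e) (λ (p , q) → loopless f (trans p (sym q))))
      (==-∧-false (head f) (tail e) (head f) (head e) (λ (p , q) → loopless e (trans (sym p) q)))

  lineAdj-sym : ∀ f g → lineAdj G f g ≡ lineAdj G g f
  lineAdj-sym f g
    rewrite ==-sym g f | ==-sym (tail g) (tail f) | ==-sym (tail g) (head f)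
          | ==-sym (head g) (tail f) | ==-sym (head g) (head f)
    = cong (not (f == g) ∧_)
           (∨-swap-middle (tail f == tail g) (tail f == head g) (head f == tail g) (head f == head g))

  module _ (o : Fin m → Fin m → Bool) where

    lineBond-off : ∀ {k f g} → f ≢ k → g ≢ k → lineBond G o k f g ≡ + 0
    lineBond-off {k} {f} {g} f≢k g≢k rewrite ==-false f≢k | ==-false g≢k with lineArc G o f g
    ... | true  = refl
    ... | false = refl

    lineBond-tail : ∀ {f g} → f ≢ g → lineBond G o f f g ≡ - ⟦ lineArc G o f g ⟧
    lineBond-tail {f} {g} f≢g rewrite ==-false (λ g≡f → f≢g (sym g≡f)) | ==-refl f with lineArc G o f g
    ... | true  = refl
    ... | false = refl

    lineBond-head : ∀ {f g} → f ≢ g → lineBond G o g f g ≡ ⟦ lineArc G o f g ⟧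
    lineBond-head {f} {g} f≢g rewrite ==-false f≢g | ==-refl g with lineArc G o f g
    ... | true  = refl
    ... | false = refl

    lineArc-both-ways : LineOrientation G o → ∀ f g →
      ⟦ lineArc G o f g ⟧ + ⟦ lineArc G o g f ⟧ ≡ ⟦ lineAdj G f g ⟧
    lineArc-both-ways orientation f g rewrite lineAdj-sym g f with lineAdj G f g in adj
    ... | false = refl
    ... | true rewrite orientation f g adj with o g f
    ...   | true  = refl
    ...   | false = refl

    lineBoundary-*ˡ : ∀ c z h → lineBoundary G o (λ f g → c * z f g) h ≡ c * lineBoundary G o z h
    lineBoundary-*ˡ c z h = begin
      sumFin (λ f → sumFin (λ g → lineBond G o h f g * (c * z f g)))
        ≡⟨ sumFin-cong (λ f → sumFin-cong (λ g → x∙yz≈y∙xz (lineBond G o h f g) c (z f g))) ⟩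
      sumFin (λ f → sumFin (λ g → c * (lineBond G o h f g * z f g)))
        ≡⟨ sumFin-cong (λ f → sumFin-*ˡ c (λ g → lineBond G o h f g * z f g)) ⟩
      sumFin (λ f → c * sumFin (λ g → lineBond G o h f g * z f g))
        ≡⟨ sumFin-*ˡ c (λ f → sumFin (λ g → lineBond G o h f g * z f g)) ⟩
      c * lineBoundary G o z h ∎

    lineBoundary-lineBond : LineOrientation G o → ∀ {h e} → h ≢ e →
      lineBoundary G o (lineBond G o e) h ≡ - ⟦ lineAdj G h e ⟧
    lineBoundary-lineBond orientation {h} {e} h≢e = begin
      sumFin (λ f → sumFin (P f))
        ≡⟨ sumFin-pair _ h e h≢e (λ f f≢h f≢e → sumFin-zero _ (P-off f≢h f≢e)) ⟩
      sumFin (P h) + sumFin (P e)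
        ≡⟨ cong₂ _+_ (sumFin-single _ e (λ g g≢e → right-zero h g (lineBond-off h≢e g≢e)))
                     (sumFin-single _ h (λ g g≢h → left-zero e g (lineBond-off e≢h g≢h))) ⟩
      P h e + P e h
        ≡⟨ cong₂ _+_ (cong₂ _*_ (lineBond-tail h≢e) (lineBond-head h≢e))
                     (cong₂ _*_ (lineBond-head e≢h) (lineBond-tail e≢h)) ⟩
      - ⟦ lineArc G o h e ⟧ * ⟦ lineArc G o h e ⟧ + ⟦ lineArc G o e h ⟧ * - ⟦ lineArc G o e h ⟧
        ≡⟨ cong₂ _+_ (-⟦⟧*⟦⟧ (lineArc G o h e)) (⟦⟧*-⟦⟧ (lineArc G o e h)) ⟩
      - ⟦ lineArc G o h e ⟧ + - ⟦ lineArc G o e h ⟧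
        ≡⟨ sym (neg-distrib-+ ⟦ lineArc G o h e ⟧ ⟦ lineArc G o e h ⟧) ⟩
      - (⟦ lineArc G o h e ⟧ + ⟦ lineArc G o e h ⟧)
        ≡⟨ cong -_ (lineArc-both-ways orientation h e) ⟩
      - ⟦ lineAdj G h e ⟧ ∎
      where
      P : Fin m → Fin m → ℤ
      P f g = lineBond G o h f g * lineBond G o e f g

      e≢h : e ≢ h
      e≢h e≡h = h≢e (sym e≡h)

      left-zero : ∀ f g → lineBond G o h f g ≡ + 0 → P f g ≡ + 0
      left-zero f g p = trans (cong (_* lineBond G o e f g) p) (*-zeroˡ (lineBond G o e f g))

      right-zero : ∀ f g → lineBond G o e f g ≡ + 0 → P f g ≡ + 0
      right-zero f g p = trans (cong (lineBond G o h f g *_) p) (*-zeroʳ (lineBond G o h f g))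

      P-off : ∀ {f} → f ≢ h → f ≢ e → ∀ g → P f g ≡ + 0
      P-off {f} f≢h f≢e g = by-cases (g ≟ h)
        where
        by-cases : Dec (g ≡ h) → P f g ≡ + 0
        by-cases (yes g≡h) = right-zero f g (lineBond-off f≢e (λ g≡e → h≢e (trans (sym g≡h) g≡e)))
        by-cases (no g≢h)  = left-zero f g (lineBond-off f≢h g≢h)

      -⟦⟧*⟦⟧ : ∀ b → - ⟦ b ⟧ * ⟦ b ⟧ ≡ - ⟦ b ⟧
      -⟦⟧*⟦⟧ true  = refl
      -⟦⟧*⟦⟧ false = refl

      ⟦⟧*-⟦⟧ : ∀ b → ⟦ b ⟧ * - ⟦ b ⟧ ≡ - ⟦ b ⟧
      ⟦⟧*-⟦⟧ true  = refl
      ⟦⟧*-⟦⟧ false = refl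

    lineBond-∈-lattice : ∀ c e → InLineBondLattice G o (λ f g → c * lineBond G o e f g)
    lineBond-∈-lattice c e = y , λ f g → sym (trans (sumFin-single _ e (off f g)) (at-e f g))
      where
      y : Fin m → ℤ
      y h = if h == e then c else + 0

      off : ∀ f g h → h ≢ e → y h * lineBond G o h f g ≡ + 0
      off f g h h≢e rewrite ==-false h≢e = *-zeroˡ (lineBond G o h f g)

      at-e : ∀ f g → y e * lineBond G o e f g ≡ c * lineBond G o e f g
      at-e f g rewrite ==-refl e = refl

    adjacency-∈-lattice : LineOrientation G o → ∀ T e c (x : Fin m → ℤ) →
      (∀ f → T f ≡ true → f ≢ e → x f ≡ c * ⟦ lineAdj G f e ⟧) → InLattice G o T e x
    adjacency-∈-lattice orientation T e c x on-T =
      x e - L e , (λ f → if f == e then + 0 else x f - L f) , z , lineBond-∈-lattice (- c) e , decomposition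
      where
      z : Fin m → Fin m → ℤ
      z f g = - c * lineBond G o e f g

      L : Fin m → ℤ
      L = lineBoundary G o z

      L-off : ∀ {h} → h ≢ e → L h ≡ c * ⟦ lineAdj G h e ⟧
      L-off {h} h≢e = begin
        L h                                             ≡⟨ lineBoundary-*ˡ (- c) (lineBond G o e) h ⟩
        - c * lineBoundary G o (lineBond G o e) h       ≡⟨ cong (- c *_) (lineBoundary-lineBond orientation h≢e) ⟩
        - c * - ⟦ lineAdj G h e ⟧                       ≡⟨ neg-*-neg c ⟦ lineAdj G h e ⟧ ⟩
        c * ⟦ lineAdj G h e ⟧                           ∎

      if-same : ∀ b → (if b then + 0 else + 0) ≡ + 0
      if-same true  = refl
      if-same false = refl

      decomposition : ∀ f → x f ≡ (if f == e then x e - L e else + 0)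
                                 + (if T f then + 0 else (if f == e then + 0 else x f - L f))
                                 + L f
      decomposition f with f ≟ e
      ... | yes refl = sym (trans (cong (λ t → x f - L f + t + L f) (if-same (T f)))
                                  (trans (cong (_+ L f) (+-identityʳ (x f - L f))) (minus-plus (x f) (L f))))
      ... | no f≢e with T f in f∈T
      ...   | true  = sym (trans (+-identityˡ (L f)) (trans (L-off f≢e) (sym (on-T f f∈T f≢e))))
      ...   | false = sym (trans (cong (_+ L f) (+-identityˡ (x f - L f))) (minus-plus (x f) (L f)))

    endpoint-incidence-∈-lattice : LineOrientation G o → ∀ T e c {x : Fin m → ℤ} →
      (∀ {f} → T f ≡ true → x f ≡ c * (⟦ incident G f (tail e) ⟧ + ⟦ incident G f (head e) ⟧)) →
      InLattice G o T e x
    endpoint-incidence-∈-lattice orientation T e c {x} on-T =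
      adjacency-∈-lattice orientation T e c x
        (λ f f∈T f≢e → trans (on-T f∈T) (cong (c *_) (incident-endpoints f≢e)))

lemma4p3 : ∀ {n m} (G : OrientedSimpleGraph n m) → Connected G →
    (T : Fin m → Bool) → SpanningTree G T → BipartiteOn G T →
    (o : Fin m → Fin m → Bool) → LineOrientation G o →
    (e : Fin m) →
    let v = OrientedSimpleGraph.tail G e
        w = OrientedSimpleGraph.head G e
    in CongMod G o T e (bond G v) (bond G w)
       ⊎ CongMod G o T e (bond G v) (λ f → - bond G w f)
lemma4p3 {n} {m} G _ T _ bipartite o orientation e =
  congruence (sink-or-source G bipartite v) (sink-or-source G bipartite w)
  where
  open OrientedSimpleGraph G
  v w : Fin n
  v = tail e
  w = head e

  ι : Fin m → Fin n → ℤ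
  ι f x = ⟦ incident G f x ⟧

  in-lattice : ∀ c {x : Fin m → ℤ} → (∀ {f} → T f ≡ true → x f ≡ c * (ι f v + ι f w)) → InLattice G o T e x
  in-lattice = endpoint-incidence-∈-lattice G o orientation T e

  congruence : Sink G T v ⊎ Source G T v → Sink G T w ⊎ Source G T w →
               CongMod G o T e (bond G v) (bond G w) ⊎ CongMod G o T e (bond G v) (λ f → - bond G w f)
  congruence (inj₁ v-sink) (inj₂ w-source) = inj₁ (in-lattice 1ℤ λ {f} f∈T →
    trans (cong₂ _-_ (bond-sink G v-sink f∈T) (bond-source G w-source f∈T)) (sub-neg (ι f v) (ι f w)))
  congruence (inj₂ v-source) (inj₁ w-sink) = inj₁ (in-lattice -1ℤ λ {f} f∈T →
    trans (cong₂ _-_ (bond-source G v-source f∈T) (bond-sink G w-sink f∈T)) (neg-sub (ι f v) (ι f w)))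
  congruence (inj₁ v-sink) (inj₁ w-sink) = inj₂ (in-lattice 1ℤ λ {f} f∈T →
    trans (cong₂ _-_ (bond-sink G v-sink f∈T) (cong -_ (bond-sink G w-sink f∈T))) (sub-neg (ι f v) (ι f w)))
  congruence (inj₂ v-source) (inj₂ w-source) = inj₂ (in-lattice -1ℤ λ {f} f∈T →
    trans (cong₂ _-_ (bond-source G v-source f∈T) (cong -_ (bond-source G w-source f∈T)))
          (neg-sub-neg-neg (ι f v) (ι f w)))
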